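{- Let $G=(V,E)$ be a finite simple graph of order $n$ and $T=n-1$. If $(x,y,z)$ is an optimal solution of the Time Step Model $\mathrm{TSM}(G,T)$, which minimizes $\sum_{v\in V}x^0_v$ over binary variables $x^t_v$ ($v\in V$, $t\in\{0,\ldots,T\}$), $y^t_a$ ($a\in A$, $t\in[T]$), $z^t$ ($t\in[T]$) subject to (1) $x^0_v+\sum_{t\in[T]}\sum_{a=(u,v)\in A}y^t_a=1$ for all $v$; (2) $y^t_a\le x^{t-1}_u$ for all $a=(u,v)\in A$, $t\in[T]$; (3) $y^t_a\le x^{t-1}_w$ for all $a=(u,v)\in A$, $w\in N(u)\setminus\{v\}$, $t\in[T]$; (4) $x^t_v=x^{t-1}_v+\sum_{a=(u,v)\in A}y^t_a$ for all $v$, $t\in[T]$; (5) $x^{t-1}_u-x^{t-1}_v+\sum_{w\in N(u)\setminus\{v\}}x^{t-1}_w\le\sum_{a=(w,v)\in A}y^t_a+\deg(u)-1$ for all $(u,v)\in A$, $t\in[T]$; (6) $\frac1n\sum_{v}(x^t_v-x^{t-1}_v)-z^t\le0$ for all $t\in[T]$; (7) $z^t-\sum_{v}(x^t_v-x^{t-1}_v)\le0$ for all $t\in[T]$, then $C=\{v\in V: x^0_v=1\}$ is a minimum zero forcing set of $G$.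
   Context: $[T]=\{1,\ldots,T\}$; $N(u)$ is the neighborhood, $\deg(u)=|N(u)|$; $A$ contains both arcs $(u,v),(v,u)$ for each edge. Standard zero forcing rule: a filled vertex $u$ forces a non-filled vertex $v$ if $v$ is the only non-filled neighbor of $u$. A zero forcing set is a set from which repeated forcing fills all vertices; a minimum zero forcing set has minimum cardinality. -}

module Defs where

open import Data.Bool using (Bool; true; false; if_then_else_; _∧_; not)
open import Data.Nat using (ℕ; zero; suc; _∸_; _<_; _≤_)
open import Data.Fin using (Fin; zero; suc; toℕ; _≟_)
open import Data.Fin.Subset using (Subset; ∣_∣)
open import Data.Vec using (tabulate)
open import Data.Integer using (ℤ; +_; _+_; _-_; _*_) renaming (_≤_ to _≤ℤ_)
open import Data.Product using (_×_; Σ)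
open import Relation.Nullary using (¬_)
open import Relation.Nullary.Decidable using (⌊_⌋)
open import Relation.Binary.PropositionalEquality using (_≡_)

record Graph (n : ℕ) : Set where
  field
    adj    : Fin n → Fin n → Bool
    sym    : ∀ u v → adj u v ≡ adj v u
    irrefl : ∀ v → adj v v ≡ false
open Graph public

⟦_⟧ : Bool → ℤ
⟦ b ⟧ = if b then + 1 else + 0

Σℤ : ∀ {n} → (Fin n → ℤ) → ℤ
Σℤ {zero}  f = + 0
Σℤ {suc n} f = f zero + Σℤ (λ i → f (suc i))

inNminus : ∀ {n} → Graph n → Fin n → Fin n → Fin n → Bool
inNminus G u v w = adj G u w ∧ not ⌊ w ≟ v ⌋

deg : ∀ {n} → Graph n → Fin n → ℕ
deg G u = ∣ tabulate (adj G u) ∣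

data Filled {n} (G : Graph n) (S : Fin n → Bool) : Fin n → Set where
  initial : ∀ {v} → S v ≡ true → Filled G S v
  force   : ∀ {u v} → Filled G S u → adj G u v ≡ true →
            (∀ w → adj G u w ≡ true → ¬ (w ≡ v) → Filled G S w) →
            Filled G S v

IsZeroForcingSet : ∀ {n} → Graph n → Subset n → Set
IsZeroForcingSet {n} G S = ∀ v → Filled G (Data.Vec.lookup S) v

IsMinimumZeroForcingSet : ∀ {n} → Graph n → Subset n → Set
IsMinimumZeroForcingSet {n} G C =
  IsZeroForcingSet G C × (∀ S → IsZeroForcingSet G S → ∣ C ∣ ≤ ∣ S ∣)

-- Time Step Model TSM(G,T)
-- x t v = x^t_v (t ∈ {0..T}); y t u v = y^t_(u,v) for the arc (u,v);
-- z t = z^t. Constraints indexed by t ∈ [T] are written with t = suc s, s < T.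

XVar : ℕ → Set
XVar n = ℕ → Fin n → Bool

YVar : ℕ → Set
YVar n = ℕ → Fin n → Fin n → Bool

ZVar : Set
ZVar = ℕ → Bool

inflow : ∀ {n} → Graph n → YVar n → ℕ → Fin n → ℤ
inflow G y t v = Σℤ (λ u → if adj G u v then ⟦ y t u v ⟧ else + 0)

record Feasible {n} (G : Graph n) (T : ℕ) (x : XVar n) (y : YVar n) (z : ZVar) : Set where
  field
    c1 : ∀ v → ⟦ x 0 v ⟧ + Σℤ {T} (λ i → inflow G y (suc (toℕ i)) v) ≡ + 1
    c2 : ∀ u v s → s < T → adj G u v ≡ true →
         ⟦ y (suc s) u v ⟧ ≤ℤ ⟦ x s u ⟧
    c3 : ∀ u v w s → s < T → adj G u v ≡ true → inNminus G u v w ≡ true →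
         ⟦ y (suc s) u v ⟧ ≤ℤ ⟦ x s w ⟧
    c4 : ∀ v s → s < T → ⟦ x (suc s) v ⟧ ≡ ⟦ x s v ⟧ + inflow G y (suc s) v
    c5 : ∀ u v s → s < T → adj G u v ≡ true →
         ⟦ x s u ⟧ - ⟦ x s v ⟧ + Σℤ (λ w → if inNminus G u v w then ⟦ x s w ⟧ else + 0)
           ≤ℤ inflow G y (suc s) v + (+ deg G u) - + 1
    -- (6) multiplied by n > 0:  Σ_v (x^t_v - x^{t-1}_v) ≤ n z^t
    c6 : ∀ s → s < T → Σℤ (λ v → ⟦ x (suc s) v ⟧ - ⟦ x s v ⟧) ≤ℤ (+ n) * ⟦ z (suc s) ⟧
    c7 : ∀ s → s < T → ⟦ z (suc s) ⟧ - Σℤ (λ v → ⟦ x (suc s) v ⟧ - ⟦ x s v ⟧) ≤ℤ + 0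

objective : ∀ {n} → XVar n → ℤ
objective x = Σℤ (λ v → ⟦ x 0 v ⟧)

record Optimal {n} (G : Graph n) (T : ℕ) (x : XVar n) (y : YVar n) (z : ZVar) : Set where
  field
    feasible : Feasible G T x y z
    minimal  : ∀ x′ y′ z′ → Feasible G T x′ y′ z′ → objective x ≤ℤ objective x′

initialSet : ∀ {n} → XVar n → Subset n
initialSet x = tabulate (x 0)

{-# OPTIONS --safe #-}
-- A feasible solution of TSM(G, T) is a record of forces: y^t_(u,v) = 1 needs u and all
-- its other neighbours filled at time t - 1, so by induction on t every vertex filled at
-- time t is filled from C by zero forcing, and telescoping (4) against (1) shows that every
-- vertex is filled at time T.  Conversely, from any zero forcing set S, forcing at each step
-- every vertex that can be forced (by one chosen forcer) is a feasible solution of objective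
-- |S|: (5) holds because whatever can be forced is forced, and the filled set grows strictly
-- until it is closed under forcing, hence contains everything S fills, so after n - 1 steps
-- it is all of V.  Optimality of C therefore gives |C| ≤ |S|.

module Submission where

open import Defs
open import Data.Nat using (ℕ; _∸_)

open import Data.Bool using (Bool; true; false; _∧_; _∨_; not; if_then_else_)
open import Data.Bool.Properties using (∧-identityʳ; ∧-zeroʳ; ∨-zeroʳ; ¬-not) renaming (_≟_ to _≟ᵇ_)
open import Data.Fin using (Fin; zero; suc; toℕ; _≟_)
open import Data.Fin.Properties using (any?; all?; ¬∀⟶∃¬; suc-injective)
open import Data.Fin.Subset using (Subset; ∣_∣; _∈_; _⊆_; ⁅_⁆; ⊤; ⊥)
open import Data.Fin.Subset.Properties
  using (∣p∣≤n; ∣p∣≡n⇒p≡⊤; p⊆q⇒∣p∣≤∣q∣; p⊂q⇒∣p∣<∣q∣; ∣⊥∣≡0; ∣⁅x⁆∣≡1; ∉⊥; x∈⁅y⁆⇒x≡y)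
open import Data.Integer using (ℤ; +_; _+_; _-_; _*_; +≤+) renaming (_≤_ to _≤ℤ_)
import Data.Integer as ℤ
import Data.Integer.Properties as ℤ
open import Data.Maybe using (Maybe; just; nothing; is-just; maybe′)
open import Data.Nat as ℕ using (zero; suc; _≤_; _<_; z≤n; s≤s)
import Data.Nat.Properties as ℕ
open import Data.Product using (_×_; _,_; ∃; map₂)
open import Data.Sum using (_⊎_; inj₁; inj₂)
open import Data.Vec using (tabulate; lookup)
open import Data.Vec.Properties
  using (lookup∘tabulate; tabulate∘lookup; tabulate-cong; []=⇒lookup; lookup⇒[]=; lookup-replicate)
open import Function using (_∘_)
open import Relation.Nullary using (¬_; Dec; yes; no; contradiction)
open import Relation.Nullary.Decidable using (⌊_⌋; map′; _×-dec_; _→-dec_; ⌊⌋-map′)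
open import Relation.Binary.PropositionalEquality as ≡
  using (_≡_; _≢_; refl; trans; cong; cong₂; subst; subst₂)

∧≡true⇒ˡ : ∀ {a b} → a ∧ b ≡ true → a ≡ true
∧≡true⇒ˡ {true} _ = refl

¬[≡true⇒≡true] : ∀ {a b} → ¬ (a ≡ true → b ≡ true) → a ≡ true × b ≡ false
¬[≡true⇒≡true] {false}         ¬a⇒b = contradiction (λ ()) ¬a⇒b
¬[≡true⇒≡true] {true}  {true}  ¬a⇒b = contradiction (λ _ → refl) ¬a⇒b
¬[≡true⇒≡true] {true}  {false} _    = refl , refl

⟦⟧-mono : ∀ {a b} → (a ≡ true → b ≡ true) → ⟦ a ⟧ ≤ℤ ⟦ b ⟧
⟦⟧-mono {false} {false} _ = +≤+ z≤n
⟦⟧-mono {false} {true}  _ = +≤+ z≤n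
⟦⟧-mono {true}  a⇒b rewrite a⇒b refl = ℤ.≤-refl

⟦⟧-≤⇒ : ∀ {a b} → ⟦ a ⟧ ≤ℤ ⟦ b ⟧ → a ≡ true → b ≡ true
⟦⟧-≤⇒ {b = true}     _        _    = refl
⟦⟧-≤⇒ {true} {false} (+≤+ ()) refl

⟦⟧≡1⇒true : ∀ {b} → ⟦ b ⟧ ≡ + 1 → b ≡ true
⟦⟧≡1⇒true {true} _ = refl

if-⟦⟧ : ∀ a b → (if a then ⟦ b ⟧ else + 0) ≡ ⟦ a ∧ b ⟧
if-⟦⟧ true  b = refl
if-⟦⟧ false b = refl

if-⟦⟧-absorb : ∀ {a b} → (b ≡ true → a ≡ true) → (if a then ⟦ b ⟧ else + 0) ≡ ⟦ b ⟧
if-⟦⟧-absorb {true}          _   = refl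
if-⟦⟧-absorb {false} {false} _   = refl
if-⟦⟧-absorb {false} {true}  b⇒a = contradiction (b⇒a refl) λ ()

⟦∨⟧ : ∀ a b → (b ≡ true → a ≡ false) → ⟦ a ∨ b ⟧ ≡ ⟦ a ⟧ + ⟦ b ⟧
⟦∨⟧ false b     _    = ≡.sym (ℤ.+-identityˡ ⟦ b ⟧)
⟦∨⟧ true  false _    = refl
⟦∨⟧ true  true  b⇒¬a = contradiction (b⇒¬a refl) λ ()

⟦∨⟧-⟦⟧ : ∀ a b → (b ≡ true → a ≡ false) → ⟦ a ∨ b ⟧ - ⟦ a ⟧ ≡ ⟦ b ⟧
⟦∨⟧-⟦⟧ false false _    = refl
⟦∨⟧-⟦⟧ false true  _    = refl
⟦∨⟧-⟦⟧ true  false _    = refl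
⟦∨⟧-⟦⟧ true  true  b⇒¬a = contradiction (b⇒¬a refl) λ ()

≤-⟦⟧+ : ∀ f {k m} → k ≤ m → + k ≤ℤ ⟦ f ⟧ + + m
≤-⟦⟧+ false k≤m = +≤+ k≤m
≤-⟦⟧+ true  k≤m = +≤+ (ℕ.m≤n⇒m≤1+n k≤m)

+c≤n*⟦0<c⟧ : ∀ {n c} → c ≤ n → + c ≤ℤ + n * ⟦ ⌊ 0 ℕ.<? c ⌋ ⟧
+c≤n*⟦0<c⟧ {n} {zero}  _   rewrite ℤ.*-zeroʳ (+ n)     = +≤+ z≤n
+c≤n*⟦0<c⟧ {n} {suc c} c≤n rewrite ℤ.*-identityʳ (+ n) = +≤+ c≤n

⟦0<c⟧≤c : ∀ c → ⟦ ⌊ 0 ℕ.<? c ⌋ ⟧ ≤ℤ + c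
⟦0<c⟧≤c zero    = +≤+ z≤n
⟦0<c⟧≤c (suc c) = +≤+ (s≤s z≤n)

-- Constraint (5) is the linear form of "a ∧ ¬ b ∧ k = m ⇒ f", where k of m neighbours are filled.
implication-encoding : ∀ a b f {k m} → k ≤ m → (a ≡ true → b ≡ false → k < m ⊎ f ≡ true) →
                       ⟦ a ⟧ - ⟦ b ⟧ + + k ≤ℤ ⟦ f ⟧ + + suc m - + 1
implication-encoding a b f {k} {m} k≤m hyp
  rewrite ℤ.+-assoc ⟦ f ⟧ (+ suc m) (ℤ.- + 1) = encode a b hyp
  where
    encode : ∀ a b → (a ≡ true → b ≡ false → k < m ⊎ f ≡ true) →
             ⟦ a ⟧ - ⟦ b ⟧ + + k ≤ℤ ⟦ f ⟧ + + m
    encode false false _ = ≤-⟦⟧+ f k≤m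
    encode false true  _ = ℤ.≤-trans (ℤ.m⊖n≤m k 1) (≤-⟦⟧+ f k≤m)
    encode true  true  _ = ≤-⟦⟧+ f k≤m
    encode true  false h with h refl refl
    ... | inj₁ k<m  = ≤-⟦⟧+ f k<m
    ... | inj₂ refl = +≤+ (s≤s k≤m)

Σℤ-cong : ∀ {n} {f g : Fin n → ℤ} → (∀ i → f i ≡ g i) → Σℤ f ≡ Σℤ g
Σℤ-cong {zero}  _   = refl
Σℤ-cong {suc n} f≗g = cong₂ _+_ (f≗g zero) (Σℤ-cong (f≗g ∘ suc))

Σℤ-zero : ∀ {n} {f : Fin n → ℤ} → (∀ i → f i ≡ + 0) → Σℤ f ≡ + 0
Σℤ-zero {zero}  _   = refl
Σℤ-zero {suc n} f≡0 = cong₂ _+_ (f≡0 zero) (Σℤ-zero (f≡0 ∘ suc))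

Σℤ≢0⇒∃≢0 : ∀ {n} (f : Fin n → ℤ) → Σℤ f ≢ + 0 → ∃ λ i → f i ≢ + 0
Σℤ≢0⇒∃≢0 {n} f Σ≢0 = ¬∀⟶∃¬ n _ (λ i → f i ℤ.≟ + 0) (Σ≢0 ∘ Σℤ-zero)

Σℤ-⟦⟧ : ∀ {n} (f : Fin n → Bool) → Σℤ (λ i → ⟦ f i ⟧) ≡ + ∣ tabulate f ∣
Σℤ-⟦⟧ {zero}  f = refl
Σℤ-⟦⟧ {suc n} f with f zero
... | true  = cong ℤ.suc (Σℤ-⟦⟧ (f ∘ suc))
... | false = trans (ℤ.+-identityˡ _) (Σℤ-⟦⟧ (f ∘ suc))

Σℤ-telescope : ∀ T (a d : ℕ → ℤ) → (∀ s → s < T → a (suc s) ≡ a s + d (suc s)) →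
               a 0 + Σℤ {T} (λ i → d (suc (toℕ i))) ≡ a T
Σℤ-telescope zero    a d _    = ℤ.+-identityʳ (a 0)
Σℤ-telescope (suc T) a d step = begin
  a 0 + (d 1 + rest)  ≡⟨ ≡.sym (ℤ.+-assoc (a 0) (d 1) rest) ⟩
  a 0 + d 1 + rest    ≡⟨ cong (_+ rest) (≡.sym (step 0 (s≤s z≤n))) ⟩
  a 1 + rest          ≡⟨ Σℤ-telescope T (a ∘ suc) (d ∘ suc) (λ s s<T → step (suc s) (s≤s s<T)) ⟩
  a (suc T)           ∎
  where
    open ≡.≡-Reasoning
    rest : ℤ
    rest = Σℤ {T} (λ i → d (suc (suc (toℕ i))))

∈-tabulate⁺ : ∀ {n} {f : Fin n → Bool} {i} → f i ≡ true → i ∈ tabulate f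
∈-tabulate⁺ {f = f} {i} fi = lookup⇒[]= i (tabulate f) (trans (lookup∘tabulate f i) fi)

∈-tabulate⁻ : ∀ {n} {f : Fin n → Bool} {i} → i ∈ tabulate f → f i ≡ true
∈-tabulate⁻ {f = f} {i} i∈f = trans (≡.sym (lookup∘tabulate f i)) ([]=⇒lookup i∈f)

tabulate-⊆ : ∀ {n} {f g : Fin n → Bool} → (∀ i → f i ≡ true → g i ≡ true) →
             tabulate f ⊆ tabulate g
tabulate-⊆ f⇒g {i} i∈f = ∈-tabulate⁺ (f⇒g i (∈-tabulate⁻ i∈f))

∣tabulate∣-mono-≤ : ∀ {n} {f g : Fin n → Bool} → (∀ i → f i ≡ true → g i ≡ true) →
                    ∣ tabulate f ∣ ≤ ∣ tabulate g ∣
∣tabulate∣-mono-≤ f⇒g = p⊆q⇒∣p∣≤∣q∣ (tabulate-⊆ f⇒g)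

∣tabulate∣-mono-< : ∀ {n} {f g : Fin n → Bool} → (∀ i → f i ≡ true → g i ≡ true) →
                    ∀ {j} → f j ≡ false → g j ≡ true → ∣ tabulate f ∣ < ∣ tabulate g ∣
∣tabulate∣-mono-< f⇒g {j} fj gj = p⊂q⇒∣p∣<∣q∣
  ( tabulate-⊆ f⇒g
  , j , ∈-tabulate⁺ gj , λ j∈f → contradiction (trans (≡.sym fj) (∈-tabulate⁻ j∈f)) λ () )

∣tabulate∣>0 : ∀ {n} {f : Fin n → Bool} {i} → f i ≡ true → 0 < ∣ tabulate f ∣
∣tabulate∣>0 {f = f} fi =
  ℕ.≤-<-trans z≤n (∣tabulate∣-mono-< {f = λ _ → false} {g = f} (λ _ ()) refl fi)

∣tabulate∣≥n⇒true : ∀ {n} (f : Fin n → Bool) → n ≤ ∣ tabulate f ∣ → ∀ i → f i ≡ true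
∣tabulate∣≥n⇒true {n} f n≤∣f∣ i = begin
  f i                    ≡⟨ ≡.sym (lookup∘tabulate f i) ⟩
  lookup (tabulate f) i  ≡⟨ cong (λ p → lookup p i) (∣p∣≡n⇒p≡⊤ {p = tabulate f} ∣f∣≡n) ⟩
  lookup ⊤ i             ≡⟨ lookup-replicate i true ⟩
  true                   ∎
  where
    open ≡.≡-Reasoning
    ∣f∣≡n : ∣ tabulate f ∣ ≡ n
    ∣f∣≡n = ℕ.≤-antisym (∣p∣≤n (tabulate f)) n≤∣f∣

∣tabulate∣-remove : ∀ {n} (f : Fin n → Bool) v → f v ≡ true →
                    ∣ tabulate f ∣ ≡ suc ∣ tabulate (λ w → f w ∧ not ⌊ w ≟ v ⌋) ∣
∣tabulate∣-remove {suc n} f zero fv rewrite fv =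
  cong (ℕ.suc ∘ ∣_∣) (tabulate-cong (λ w → ≡.sym (∧-identityʳ (f (suc w)))))
-- ⌊ suc w ≟ suc v ⌋ does not reduce to ⌊ w ≟ v ⌋, hence the rewrite by ⌊⌋-map′.
∣tabulate∣-remove {suc n} f (suc v) fv
  rewrite tabulate-cong (λ w → cong (λ b → f (suc w) ∧ not b)
                                    (⌊⌋-map′ (cong suc) suc-injective (w ≟ v)))
  with f zero
... | true  = cong ℕ.suc (∣tabulate∣-remove (f ∘ suc) v fv)
... | false = ∣tabulate∣-remove (f ∘ suc) v fv

witness : ∀ {n} {P : Fin n → Set} → Dec (∃ P) → Maybe (Fin n)
witness (yes (u , _)) = just u
witness (no _)        = nothing

witness-sound : ∀ {n} {P : Fin n → Set} (d : Dec (∃ P)) {u} → witness d ≡ just u → P u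
witness-sound (yes (u , Pu)) refl = Pu

witness-complete : ∀ {n} {P : Fin n → Set} (d : Dec (∃ P)) {u} → P u → is-just (witness d) ≡ true
witness-complete (yes _) _  = refl
witness-complete (no ∄)  Pu = contradiction (_ , Pu) ∄

⁅_⁆ₘ : ∀ {n} → Maybe (Fin n) → Subset n
⁅_⁆ₘ = maybe′ ⁅_⁆ ⊥

∣⁅⁆ₘ∣ : ∀ {n} (m : Maybe (Fin n)) → + ∣ ⁅ m ⁆ₘ ∣ ≡ ⟦ is-just m ⟧
∣⁅⁆ₘ∣ (just u)    = cong +_ (∣⁅x⁆∣≡1 u)
∣⁅⁆ₘ∣ {n} nothing = cong +_ (∣⊥∣≡0 n)

∈⁅⁆ₘ⇒ : ∀ {n} (m : Maybe (Fin n)) {u} → lookup ⁅ m ⁆ₘ u ≡ true → m ≡ just u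
∈⁅⁆ₘ⇒ (just u′) {u} e = cong just (≡.sym (x∈⁅y⁆⇒x≡y u′ (lookup⇒[]= u _ e)))
∈⁅⁆ₘ⇒ nothing   {u} e = contradiction (lookup⇒[]= u ⊥ e) ∉⊥

inNminus⁺ : ∀ {n} (G : Graph n) {u v w} → adj G u w ≡ true → w ≢ v → inNminus G u v w ≡ true
inNminus⁺ G {u} {v} {w} uw w≢v with adj G u w | w ≟ v
inNminus⁺ G refl w≢v | true | no _    = refl
inNminus⁺ G refl w≢v | true | yes w≡v = contradiction w≡v w≢v

inNminus⁻ : ∀ {n} (G : Graph n) {u v w} → inNminus G u v w ≡ true → adj G u w ≡ true × w ≢ v
inNminus⁻ G {u} {v} {w} e with adj G u w | w ≟ v
... | true | no w≢v = refl , w≢v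

Filled⇒∃initial : ∀ {n} {G : Graph n} {S v} → Filled G S v → ∃ λ u → S u ≡ true
Filled⇒∃initial (initial {v} Sv) = v , Sv
Filled⇒∃initial (force Fu _ _)   = Filled⇒∃initial Fu

OthersFilled : ∀ {n} → Graph n → (Fin n → Bool) → Fin n → Fin n → Set
OthersFilled G xs u v = ∀ w → inNminus G u v w ≡ true → xs w ≡ true

otherFilled? : ∀ {n} (G : Graph n) (xs : Fin n → Bool) u v w →
               Dec (inNminus G u v w ≡ true → xs w ≡ true)
otherFilled? G xs u v w = (inNminus G u v w ≟ᵇ true) →-dec (xs w ≟ᵇ true)

othersFilled? : ∀ {n} (G : Graph n) (xs : Fin n → Bool) u v → Dec (OthersFilled G xs u v)
othersFilled? G xs u v = all? (otherFilled? G xs u v)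

¬OthersFilled⇒∃empty : ∀ {n} (G : Graph n) (xs : Fin n → Bool) u v → ¬ OthersFilled G xs u v →
                       ∃ λ w → inNminus G u v w ≡ true × xs w ≡ false
¬OthersFilled⇒∃empty {n} G xs u v =
  map₂ ¬[≡true⇒≡true] ∘ ¬∀⟶∃¬ n _ (otherFilled? G xs u v)

record Forces {n} (G : Graph n) (xs : Fin n → Bool) (u v : Fin n) : Set where
  constructor forces
  field
    arc          : adj G u v ≡ true
    sourceFilled : xs u ≡ true
    targetEmpty  : xs v ≡ false
    othersFilled : OthersFilled G xs u v

forces? : ∀ {n} (G : Graph n) (xs : Fin n → Bool) u v → Dec (Forces G xs u v)
forces? G xs u v =
  map′ (λ (a , s , t , o) → forces a s t o) (λ (forces a s t o) → a , s , t , o)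
       ((adj G u v ≟ᵇ true) ×-dec (xs u ≟ᵇ true) ×-dec (xs v ≟ᵇ false) ×-dec othersFilled? G xs u v)

forcing-inequality : ∀ {n} (G : Graph n) (xs : Fin n → Bool) {u v} (forced : Bool) →
                     adj G u v ≡ true → (Forces G xs u v → forced ≡ true) →
                     ⟦ xs u ⟧ - ⟦ xs v ⟧ + Σℤ (λ w → if inNminus G u v w then ⟦ xs w ⟧ else + 0)
                       ≤ℤ ⟦ forced ⟧ + (+ deg G u) - + 1
forcing-inequality {n} G xs {u} {v} forced uv forces⇒forced =
  subst₂ _≤ℤ_ (cong (λ σ → ⟦ xs u ⟧ - ⟦ xs v ⟧ + σ) Σ-filledOthers)
              (cong (λ d → ⟦ forced ⟧ + + d - + 1) (≡.sym degree))
              (implication-encoding (xs u) (xs v) forced filledOthers≤others tight)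
  where
    others filledOther : Fin n → Bool
    others          = inNminus G u v
    filledOther w   = others w ∧ xs w

    Σ-filledOthers : + ∣ tabulate filledOther ∣ ≡ Σℤ (λ w → if others w then ⟦ xs w ⟧ else + 0)
    Σ-filledOthers = ≡.sym (trans (Σℤ-cong (λ w → if-⟦⟧ (others w) (xs w))) (Σℤ-⟦⟧ filledOther))

    degree : deg G u ≡ suc ∣ tabulate others ∣
    degree = ∣tabulate∣-remove (adj G u) v uv

    filledOthers≤others : ∣ tabulate filledOther ∣ ≤ ∣ tabulate others ∣
    filledOthers≤others = ∣tabulate∣-mono-≤ {f = filledOther} (λ _ → ∧≡true⇒ˡ)

    tight : xs u ≡ true → xs v ≡ false →
            ∣ tabulate filledOther ∣ < ∣ tabulate others ∣ ⊎ forced ≡ true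
    tight u∈ v∉ with othersFilled? G xs u v
    ... | yes filled = inj₂ (forces⇒forced (forces uv u∈ v∉ filled))
    ... | no ¬filled with ¬OthersFilled⇒∃empty G xs u v ¬filled
    ... | w , other , empty =
      inj₁ (∣tabulate∣-mono-< {f = filledOther} (λ _ → ∧≡true⇒ˡ)
                              (trans (cong (others w ∧_) empty) (∧-zeroʳ _)) other)

inflow≢0⇒arc : ∀ {n} (G : Graph n) (y : YVar n) t v → inflow G y t v ≢ + 0 →
               ∃ λ u → adj G u v ≡ true × y t u v ≡ true
inflow≢0⇒arc G y t v inflow≢0 with Σℤ≢0⇒∃≢0 _ inflow≢0
... | u , term≢0 with adj G u v in uv | y t u v in yuv
... | true  | true  = u , uv , yuv
... | true  | false = contradiction refl term≢0
... | false | _     = contradiction refl term≢0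

module FeasibleSolution {n} {G : Graph n} {T} {x : XVar n} {y : YVar n} {z : ZVar}
                        (feasible : Feasible G T x y z) where
  open Feasible feasible

  newly-filled⇒inflow≢0 : ∀ s → s < T → ∀ {v} → x s v ≡ false → x (suc s) v ≡ true →
                          inflow G y (suc s) v ≢ + 0
  newly-filled⇒inflow≢0 s s<T {v} before after inflow≡0 = contradiction (begin
    + 1                               ≡⟨ cong ⟦_⟧ (≡.sym after) ⟩
    ⟦ x (suc s) v ⟧                   ≡⟨ c4 v s s<T ⟩
    ⟦ x s v ⟧ + inflow G y (suc s) v  ≡⟨ cong₂ _+_ (cong ⟦_⟧ before) inflow≡0 ⟩
    + 0                               ∎) λ ()
    where open ≡.≡-Reasoning

  filled⇒Filled : ∀ s → s ≤ T → ∀ v → x s v ≡ true → Filled G (lookup (initialSet x)) v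
  filled⇒Filled zero    _   v x₀v = initial (trans (lookup∘tabulate (x 0) v) x₀v)
  filled⇒Filled (suc s) s<T v xv with x s v in before
  ... | true  = filled⇒Filled s (ℕ.<⇒≤ s<T) v before
  ... | false with inflow≢0⇒arc G y (suc s) v (newly-filled⇒inflow≢0 s s<T before xv)
  ... | u , uv , yuv =
    force (IH u (⟦⟧-≤⇒ (c2 u v s s<T uv) yuv)) uv
          (λ w uw w≢v → IH w (⟦⟧-≤⇒ (c3 u v w s s<T uv (inNminus⁺ G uw w≢v)) yuv))
    where
      IH : ∀ w → x s w ≡ true → Filled G (lookup (initialSet x)) w
      IH = filled⇒Filled s (ℕ.<⇒≤ s<T)

  filled-at-T : ∀ v → x T v ≡ true
  filled-at-T v = ⟦⟧≡1⇒true (begin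
    ⟦ x T v ⟧
      ≡⟨ ≡.sym (Σℤ-telescope T (λ s → ⟦ x s v ⟧) (λ t → inflow G y t v) (λ s → c4 v s)) ⟩
    ⟦ x 0 v ⟧ + Σℤ {T} (λ i → inflow G y (suc (toℕ i)) v)
      ≡⟨ c1 v ⟩
    + 1 ∎)
    where open ≡.≡-Reasoning

  initialSet-isZeroForcingSet : IsZeroForcingSet G (initialSet x)
  initialSet-isZeroForcingSet v = filled⇒Filled T ℕ.≤-refl v (filled-at-T v)

module MaximalForcing {n} (G : Graph n) (S : Subset n) where

  forcer : (Fin n → Bool) → Fin n → Maybe (Fin n)
  forcer xs v = witness (any? (λ u → forces? G xs u v))

  forced : (Fin n → Bool) → Fin n → Bool
  forced xs v = is-just (forcer xs v)

  forcer-forces : ∀ {xs v u} → forcer xs v ≡ just u → Forces G xs u v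
  forcer-forces {xs} {v} = witness-sound (any? (λ u → forces? G xs u v))

  forces⇒forced : ∀ {xs u v} → Forces G xs u v → forced xs v ≡ true
  forces⇒forced {xs} {v = v} = witness-complete (any? (λ u → forces? G xs u v))

  forced⇒empty : ∀ {xs v} → forced xs v ≡ true → xs v ≡ false
  forced⇒empty {xs} {v} _ with forcer xs v in forcer≡
  ... | just u = Forces.targetEmpty (forcer-forces forcer≡)

  X : XVar n
  X zero    v = lookup S v
  X (suc s) v = X s v ∨ forced (X s) v

  -- The values of Y and Z at t = 0 are not constrained by the model.
  Y : YVar n
  Y zero    _ _ = false
  Y (suc s) u v = lookup ⁅ forcer (X s) v ⁆ₘ u

  Z : ZVar
  Z zero    = false
  Z (suc s) = ⌊ 0 ℕ.<? ∣ tabulate (forced (X s)) ∣ ⌋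

  X-mono : ∀ s {v} → X s v ≡ true → X (suc s) v ≡ true
  X-mono s {v} = cong (_∨ forced (X s) v)

  forced⇒X-suc : ∀ s {v} → forced (X s) v ≡ true → X (suc s) v ≡ true
  forced⇒X-suc s {v} fv = trans (cong (X s v ∨_) fv) (∨-zeroʳ _)

  S⊆X : ∀ s {v} → lookup S v ≡ true → X s v ≡ true
  S⊆X zero    Sv = Sv
  S⊆X (suc s) Sv = X-mono s (S⊆X s Sv)

  Y-forces : ∀ {s u v} → Y (suc s) u v ≡ true → Forces G (X s) u v
  Y-forces {s} {u} {v} = forcer-forces ∘ ∈⁅⁆ₘ⇒ (forcer (X s) v)

  stable⇒Filled⊆X : ∀ s → (∀ v → forced (X s) v ≡ false) →
                    ∀ {v} → Filled G (lookup S) v → X s v ≡ true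
  stable⇒Filled⊆X s stable (initial Sv) = S⊆X s Sv
  stable⇒Filled⊆X s stable {v} (force {u} Fu uv others) with X s v ≟ᵇ true
  ... | yes filled = filled
  ... | no ¬filled = contradiction (trans (≡.sym (forces⇒forced u-forces-v)) (stable v)) λ ()
    where
      u-forces-v : Forces G (X s) u v
      u-forces-v = forces uv (stable⇒Filled⊆X s stable Fu) (¬-not ¬filled) λ w other →
        let uw , w≢v = inNminus⁻ G other in stable⇒Filled⊆X s stable (others w uw w≢v)

  X-grows : IsZeroForcingSet G S → ∀ s → (∀ v → X s v ≡ true) ⊎ s < ∣ tabulate (X s) ∣
  X-grows zf zero with any? (λ v → lookup S v ≟ᵇ true)
  ... | yes (_ , Sv) = inj₂ (∣tabulate∣>0 {f = X 0} Sv)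
  ... | no ∄         = inj₁ (λ v → contradiction (Filled⇒∃initial (zf v)) ∄)
  X-grows zf (suc s) with X-grows zf s | any? (λ v → forced (X s) v ≟ᵇ true)
  ... | inj₁ full  | _            = inj₁ (λ v → X-mono s (full v))
  ... | inj₂ s<∣X∣ | yes (v , fv) = inj₂ (ℕ.≤-<-trans s<∣X∣ ∣X∣<∣X-suc∣)
    where
      ∣X∣<∣X-suc∣ : ∣ tabulate (X s) ∣ < ∣ tabulate (X (suc s)) ∣
      ∣X∣<∣X-suc∣ = ∣tabulate∣-mono-< {f = X s} (λ _ → X-mono s)
                                      (forced⇒empty {X s} fv) (forced⇒X-suc s fv)
  ... | inj₂ _     | no ∄         =
    inj₁ (λ v → X-mono s (stable⇒Filled⊆X s (λ v → ¬-not (∄ ∘ (v ,_))) (zf v)))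

  X-full : IsZeroForcingSet G S → ∀ v → X (n ∸ 1) v ≡ true
  X-full zf v with X-grows zf (n ∸ 1)
  ... | inj₁ full     = full v
  ... | inj₂ n∸1<∣X∣ = ∣tabulate∣≥n⇒true (X (n ∸ 1)) (ℕ.≤-trans (ℕ.m≤n+m∸n n 1) n∸1<∣X∣) v

  inflow-Y : ∀ s v → inflow G Y (suc s) v ≡ ⟦ forced (X s) v ⟧
  inflow-Y s v = begin
    Σℤ (λ u → if adj G u v then ⟦ Y (suc s) u v ⟧ else + 0)
      ≡⟨ Σℤ-cong (λ u → if-⟦⟧-absorb (Forces.arc ∘ Y-forces {s} {u} {v})) ⟩
    Σℤ (λ u → ⟦ Y (suc s) u v ⟧)
      ≡⟨ Σℤ-⟦⟧ (λ u → Y (suc s) u v) ⟩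
    + ∣ tabulate (lookup ⁅ forcer (X s) v ⁆ₘ) ∣
      ≡⟨ cong (+_ ∘ ∣_∣) (tabulate∘lookup ⁅ forcer (X s) v ⁆ₘ) ⟩
    + ∣ ⁅ forcer (X s) v ⁆ₘ ∣
      ≡⟨ ∣⁅⁆ₘ∣ (forcer (X s) v) ⟩
    ⟦ forced (X s) v ⟧ ∎
    where open ≡.≡-Reasoning

  X-step : ∀ s v → ⟦ X (suc s) v ⟧ ≡ ⟦ X s v ⟧ + inflow G Y (suc s) v
  X-step s v = trans (⟦∨⟧ (X s v) (forced (X s) v) forced⇒empty)
                     (cong (_+_ ⟦ X s v ⟧) (≡.sym (inflow-Y s v)))

  Σ-increments : ∀ s → Σℤ (λ v → ⟦ X (suc s) v ⟧ - ⟦ X s v ⟧) ≡ + ∣ tabulate (forced (X s)) ∣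
  Σ-increments s = trans (Σℤ-cong (λ v → ⟦∨⟧-⟦⟧ (X s v) (forced (X s) v) forced⇒empty))
                         (Σℤ-⟦⟧ (forced (X s)))

  feasible : IsZeroForcingSet G S → Feasible G (n ∸ 1) X Y Z
  feasible zf = record
    { c1 = λ v → trans (Σℤ-telescope (n ∸ 1) (λ s → ⟦ X s v ⟧) (λ t → inflow G Y t v)
                                     (λ s _ → X-step s v))
                       (cong ⟦_⟧ (X-full zf v))
    ; c2 = λ u v s _ _ → ⟦⟧-mono (Forces.sourceFilled ∘ Y-forces {s})
    ; c3 = λ u v w s _ _ other → ⟦⟧-mono (λ yuv → Forces.othersFilled (Y-forces {s} yuv) w other)
    ; c4 = λ v s _ → X-step s v
    ; c5 = λ u v s _ uv →
        subst (λ i → ⟦ X s u ⟧ - ⟦ X s v ⟧ + Σℤ (λ w → if inNminus G u v w then ⟦ X s w ⟧ else + 0)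
                       ≤ℤ i + (+ deg G u) - + 1)
              (≡.sym (inflow-Y s v))
              (forcing-inequality G (X s) (forced (X s) v) uv forces⇒forced)
    ; c6 = λ s _ → subst (_≤ℤ + n * ⟦ Z (suc s) ⟧) (≡.sym (Σ-increments s))
                         (+c≤n*⟦0<c⟧ (∣p∣≤n (tabulate (forced (X s)))))
    ; c7 = λ s _ → subst (λ σ → ⟦ Z (suc s) ⟧ - σ ≤ℤ + 0) (≡.sym (Σ-increments s))
                         (ℤ.i≤j⇒i-j≤0 (⟦0<c⟧≤c ∣ tabulate (forced (X s)) ∣))
    }

  initialSet-X : initialSet X ≡ S
  initialSet-X = tabulate∘lookup S

objective≡∣initialSet∣ : ∀ {n} (x : XVar n) → objective x ≡ + ∣ initialSet x ∣
objective≡∣initialSet∣ x = Σℤ-⟦⟧ (x 0)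

corollary4p4 : ∀ {n} (G : Graph n) (x : XVar n) (y : YVar n) (z : ZVar) →
    Optimal G (n ∸ 1) x y z → IsMinimumZeroForcingSet G (initialSet x)
corollary4p4 G x y z optimal = FeasibleSolution.initialSet-isZeroForcingSet feasible , minimum
  where
    open Optimal optimal

    minimum : ∀ S → IsZeroForcingSet G S → ∣ initialSet x ∣ ≤ ∣ S ∣
    minimum S S-zf = ℤ.drop‿+≤+ (begin
      + ∣ initialSet x ∣  ≡⟨ ≡.sym (objective≡∣initialSet∣ x) ⟩
      objective x         ≤⟨ minimal X Y Z (MaximalForcing.feasible G S S-zf) ⟩
      objective X         ≡⟨ objective≡∣initialSet∣ X ⟩
      + ∣ initialSet X ∣  ≡⟨ cong (+_ ∘ ∣_∣) initialSet-X ⟩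
      + ∣ S ∣             ∎)
      where
        open MaximalForcing G S using (X; Y; Z; initialSet-X)
        open ℤ.≤-Reasoning
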